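{- Let $(H_n)_{n\in\omega}$ be countable discrete abelian groups and $G\le\prod_nH_n$ a closed subgroup such that for all $n\in\mathbb{N}_+$, $G_{\langle n\rangle}/G_{\langle n+1\rangle}$ is torsion. Let $S\subseteq T_G$ be a group tree and $\sigma\in S$ an element of finite order. Then every $\tau\in S$ with $\sigma\subseteq\tau$ also has finite order.
   Context: With $\pi_k:\prod_nH_n\to H_k$ the projections, $G_{\langle 0\rangle}=G$ and for $m\ge1$, $G_{\langle m\rangle}=\{x\in G:\pi_k(x)=0\text{ for all }k<m\}$. For $n\ge1$ let $H^n=H_0\times\cdots\times H_{n-1}$ (a group) and $T_H=\bigcup_{n\ge1}H^n$; for $\sigma\in H^n$, $\mathrm{lh}(\sigma)=n$; $\sigma\subseteq\tau$ means $\sigma$ is the restriction of $\tau$ to its first $\mathrm{lh}(\sigma)$ coordinates, similarly $\sigma\subseteq x$ for $x\in\prod_nH_n$. A tree is a subset of $T_H$ closed under restriction; $T_G=\{\sigma\in T_H:\exists x\in G\ \sigma\subseteq x\}$. A group tree is a tree $S$ with each $S\cap H^m$ ($m\ge1$) a subgroup of $H^m$; orders of elements are taken in the group $H^{\mathrm{lh}(\sigma)}$. -}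

module Defs where

open import Level using (Level; _⊔_)
import Level
open import Algebra.Bundles using (AbelianGroup)
open import Data.Nat using (ℕ; zero; suc; _≤_; _<_; s≤s)
open import Data.Nat.Properties using (<-≤-trans)
open import Data.Product using (Σ; ∃; _×_; _,_)

module _ {c ℓ : Level} (H : ℕ → AbelianGroup c ℓ) where

  Car : ℕ → Set c
  Car n = AbelianGroup.Carrier (H n)

  _≈ᵢ_ : {i : ℕ} → Car i → Car i → Set ℓ
  _≈ᵢ_ {i} x y = AbelianGroup._≈_ (H i) x y

  0[_] : (i : ℕ) → Car i
  0[ i ] = AbelianGroup.ε (H i)

  mul : {i : ℕ} → ℕ → Car i → Car i
  mul {i} zero    x = AbelianGroup.ε (H i)
  mul {i} (suc k) x = AbelianGroup._∙_ (H i) x (mul k x)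

  Prod : Set c
  Prod = (n : ℕ) → Car n

  record IsSubgroup {g : Level} (G : Prod → Set g) : Set (c ⊔ ℓ ⊔ g) where
    field
      resp : ∀ x y → (∀ n → x n ≈ᵢ y n) → G x → G y
      zero∈ : G (λ n → 0[ n ])
      ∙∈ : ∀ x y → G x → G y → G (λ n → AbelianGroup._∙_ (H n) (x n) (y n))
      ⁻¹∈ : ∀ x → G x → G (λ n → AbelianGroup._⁻¹ (H n) (x n))

  -- G is closed in the product topology (each H_n discrete):
  -- every x all of whose initial segments extend to elements of G is in G.
  IsClosed : {g : Level} → (Prod → Set g) → Set (c ⊔ ℓ ⊔ g)
  IsClosed G = ∀ x → (∀ n → Σ Prod λ y → G y × (∀ i → i < n → y i ≈ᵢ x i)) → G x

  Countable : Set (c ⊔ ℓ)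
  Countable = ∀ n → Σ (ℕ → Car n) λ f → ∀ a → Σ ℕ λ j → f j ≈ᵢ a

  G⟨_⟩ : {g : Level} → (Prod → Set g) → ℕ → Prod → Set (ℓ ⊔ g)
  G⟨ G ⟩ m x = G x × (∀ k → k < m → x k ≈ᵢ 0[ k ])

  -- For all n ≥ 1, G_⟨n⟩ / G_⟨n+1⟩ is torsion: every coset x + G_⟨n+1⟩
  -- (x ∈ G_⟨n⟩) has finite order, i.e. some (j+1)·x lies in G_⟨n+1⟩.
  TorsionQuotients : {g : Level} → (Prod → Set g) → Set (c ⊔ ℓ ⊔ g)
  TorsionQuotients G = ∀ n → (x : Prod) → G⟨ G ⟩ (suc n) x →
    Σ ℕ λ j → G⟨ G ⟩ (suc (suc n)) (λ i → mul (suc j) (x i))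

  -- H^n = H_0 × ... × H_{n-1}; the index-bound proof is irrelevant.
  Seq : ℕ → Set c
  Seq n = (i : ℕ) → .(i < n) → Car i

  _≈s_ : {n : ℕ} → Seq n → Seq n → Set ℓ
  _≈s_ {n} σ τ = ∀ i .(p : i < n) → σ i p ≈ᵢ τ i p

  0s : (n : ℕ) → Seq n
  0s n i _ = 0[ i ]

  _+s_ : {n : ℕ} → Seq n → Seq n → Seq n
  (σ +s τ) i p = AbelianGroup._∙_ (H i) (σ i p) (τ i p)

  -s_ : {n : ℕ} → Seq n → Seq n
  (-s σ) i p = AbelianGroup._⁻¹ (H i) (σ i p)

  muls : {n : ℕ} → ℕ → Seq n → Seq n
  muls k σ i p = mul k (σ i p)

  FiniteOrder : {n : ℕ} → Seq n → Set ℓ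
  FiniteOrder {n} σ = Σ ℕ λ k → muls (suc k) σ ≈s 0s n

  restrict : {n : ℕ} → Seq n → (m : ℕ) → m ≤ n → Seq m
  restrict σ m le i p = σ i (<-≤-trans p le)

  _⊆s_ : {m n : ℕ} → Seq m → Seq n → Set ℓ
  _⊆s_ {m} {n} σ τ = Σ (m ≤ n) λ le → σ ≈s restrict τ m le

  _⊆p_ : {m : ℕ} → Seq m → Prod → Set ℓ
  _⊆p_ {m} σ x = ∀ i .(p : i < m) → σ i p ≈ᵢ x i

  -- Subsets of T_H = ⋃_{n≥1} H^n : given levelwise, S n ⊆ H^(n+1).
  TSub : (s : Level) → Set (c ⊔ Level.suc s)
  TSub s = (n : ℕ) → Seq (suc n) → Set s

  record IsGroupTree {s : Level} (S : TSub s) : Set (c ⊔ ℓ ⊔ s) where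
    field
      resp : ∀ n (σ τ : Seq (suc n)) → σ ≈s τ → S n σ → S n τ
      restr∈ : ∀ n (σ : Seq (suc n)) m (le : m ≤ n) → S n σ →
               S m (restrict σ (suc m) (s≤s le))
      zero∈ : ∀ n → S n (0s (suc n))
      +∈ : ∀ n (σ τ : Seq (suc n)) → S n σ → S n τ → S n (σ +s τ)
      -∈ : ∀ n (σ : Seq (suc n)) → S n σ → S n (-s σ)

  SubsetTG : {g s : Level} → (Prod → Set g) → TSub s → Set (c ⊔ ℓ ⊔ g ⊔ s)
  SubsetTG G S = ∀ n (σ : Seq (suc n)) → S n σ → Σ Prod λ x → G x × (σ ⊆p x)

-- If τ ∈ S is one longer than an initial segment τ' ∈ S of
-- finite order k+1, then ρ = (k+1)τ ∈ S vanishes on all coordinates but the last, so any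
-- x ∈ G extending ρ lies in G⟨lh τ'⟩. Since that quotient is torsion, some (j+1)x lies in
-- G⟨lh τ⟩, whence (j+1)ρ = (j+1)(k+1)τ = 0.
module Submission where

open import Defs
open import Level using (Level)
open import Algebra.Bundles using (AbelianGroup)
import Algebra.Properties.Monoid.Mult as MonoidMult
open import Data.Nat using (ℕ; zero; suc; _+_; _*_; _<_; _<?_; s≤s)
open import Data.Nat.Properties using (n≤1+n; m<n⇒m<1+n; m≤n⇒m<n∨m≡n)
open import Data.Product using (_,_)
open import Data.Sum using (inj₁; inj₂)
open import Relation.Nullary.Decidable using (recompute)
open import Relation.Binary.PropositionalEquality as ≡ using (_≡_; cong; subst₂)

module Multiples {c ℓ : Level} (H : ℕ → AbelianGroup c ℓ) {i : ℕ} where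
  open AbelianGroup (H i)
  open MonoidMult monoid using (_×_; ×-congʳ; ×-assocˡ)

  mul≡× : ∀ k (x : Carrier) → mul H k x ≡ k × x
  mul≡× zero    x = ≡.refl
  mul≡× (suc k) x = cong (x ∙_) (mul≡× k x)

  mul-congʳ : ∀ k {x y : Carrier} → x ≈ y → mul H k x ≈ mul H k y
  mul-congʳ k {x} {y} x≈y = subst₂ _≈_ (≡.sym (mul≡× k x)) (≡.sym (mul≡× k y)) (×-congʳ k x≈y)

  mul-assoc : ∀ a b (x : Carrier) → mul H (a * b) x ≈ mul H a (mul H b x)
  mul-assoc a b x = subst₂ _≈_ (≡.sym (mul≡× (a * b) x))
    (≡.sym (≡.trans (mul≡× a _) (cong (a ×_) (mul≡× b x))))
    (sym (×-assocˡ x a b))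

module _ {c ℓ : Level} (H : ℕ → AbelianGroup c ℓ) where
  open Multiples H
  module H (i : ℕ) = AbelianGroup (H i)

  finiteOrder-resp : ∀ {n} {σ τ : Seq H n} → _≈s_ H σ τ → FiniteOrder H σ → FiniteOrder H τ
  finiteOrder-resp σ≈τ (k , kσ≈0) =
    k , λ i p → H.trans i (mul-congʳ (suc k) (H.sym i (σ≈τ i p))) (kσ≈0 i p)

  multipleFiniteOrder⇒finiteOrder : ∀ {n} k (τ : Seq H n) →
    FiniteOrder H (muls H (suc k) τ) → FiniteOrder H τ
  multipleFiniteOrder⇒finiteOrder k τ (j , jkτ≈0) =
    k + j * suc k , λ i p → H.trans i (mul-assoc (suc j) (suc k) (τ i p)) (jkτ≈0 i p)

  muls∈ : ∀ {s} {S : TSub H s} → IsGroupTree H S →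
    ∀ n (τ : Seq H (suc n)) → S n τ → ∀ k → S n (muls H k τ)
  muls∈ tree n τ τ∈S zero    = IsGroupTree.zero∈ tree n
  muls∈ tree n τ τ∈S (suc k) = IsGroupTree.+∈ tree n τ (muls H k τ) τ∈S (muls∈ tree n τ τ∈S k)

  module _ {g s : Level} {G : Prod H → Set g} {S : TSub H s}
           (torsion : TorsionQuotients H G) (tree : IsGroupTree H S) (S⊆TG : SubsetTG H G S) where

    initFiniteOrder⇒finiteOrder : ∀ n (τ : Seq H (suc (suc n))) → S (suc n) τ →
      FiniteOrder H (restrict H τ (suc n) (n≤1+n (suc n))) → FiniteOrder H τ
    initFiniteOrder⇒finiteOrder n τ τ∈S (k , kτ'≈0)
      with S⊆TG (suc n) (muls H (suc k) τ) (muls∈ tree (suc n) τ τ∈S (suc k))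
    ... | x , x∈G , ρ⊆x with torsion n x (x∈G , λ i i<1+n →
                               H.trans i (H.sym i (ρ⊆x i (m<n⇒m<1+n i<1+n))) (kτ'≈0 i i<1+n))
    ... | j , _ , jx≈0 = multipleFiniteOrder⇒finiteOrder k τ (j , λ i p →
            H.trans i (mul-congʳ (suc j) (ρ⊆x i p)) (jx≈0 i (recompute (i <? _) p)))

    -- restrict only changes the irrelevant bound proofs, so σ ≈s restrict τ _ _ is
    -- definitionally σ ≈s τ (when lh σ = lh τ) and σ ≈s restrict τ' _ _ for τ' ⊆ τ.
    finiteOrder-upward : ∀ {m} {σ : Seq H (suc m)} → FiniteOrder H σ →
      ∀ n (τ : Seq H (suc n)) → S n τ → _⊆s_ H σ τ → FiniteOrder H τ
    finiteOrder-upward σfin n τ τ∈S (le , σ≈τ) with m≤n⇒m<n∨m≡n le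
    ... | inj₂ ≡.refl = finiteOrder-resp σ≈τ σfin
    finiteOrder-upward σfin (suc n) τ τ∈S (le , σ≈τ) | inj₁ (s≤s 1+m≤1+n) =
      initFiniteOrder⇒finiteOrder n τ τ∈S
        (finiteOrder-upward σfin n _ (IsGroupTree.restr∈ tree (suc n) τ n (n≤1+n n) τ∈S) (1+m≤1+n , σ≈τ))

lemma5p2 : {c ℓ g s : Level} (H : ℕ → AbelianGroup c ℓ) → Countable H →
    (G : Prod H → Set g) → IsSubgroup H G → IsClosed H G → TorsionQuotients H G →
    (S : TSub H s) → IsGroupTree H S → SubsetTG H G S →
    (m : ℕ) (σ : Seq H (suc m)) → S m σ → FiniteOrder H σ →
    (n : ℕ) (τ : Seq H (suc n)) → S n τ → _⊆s_ H σ τ → FiniteOrder H τ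
lemma5p2 H _ G _ _ torsion S tree S⊆TG m σ _ σfin =
  finiteOrder-upward H torsion tree S⊆TG σfin
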